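{- Let $r\ge 2$, $\ell\ge1$, and let $C=(w_1,\dots,w_{2\ell+1})$ be distinct vertices of $\Omega_n$ with $w_1<w_3<\dots<w_{2\ell+1}<w_2<\dots<w_{2\ell}<w_1$. If $|[w_i,w_{i-1}]|\ge r$ for all $i$ (indices modulo $2\ell+1$), then $H_n^{(r)}(C)$ is $M_1^{(r)}$-saturated.
   Context: $\Omega_n=\{v_0,\dots,v_{n-1}\}$ carries the cyclic (clockwise) order $v_0<\dots<v_{n-1}<v_0$. A chain $x_1<\dots<x_k<x_1$ of distinct points means they appear in this clockwise cyclic order. For $a,b\in\Omega_n$, $(a,b)$ is the set of points strictly between $a$ and $b$ travelling clockwise from $a$ to $b$, and $[a,b]=(a,b)\cup\{a,b\}$. Two $r$-sets $h_1,h_2$ form a copy of $M_1^{(r)}$ if they are disjoint and there are $a,b$ with $h_1\subseteq[a,b]$, $h_2\subseteq(b,a)$. $H\subseteq\binom{\Omega_n}{r}$ is $M_1^{(r)}$-saturated if no two edges of $H$ form a copy of $M_1^{(r)}$ and every $e\in\binom{\Omega_n}{r}\setminus H$ forms a copy of $M_1^{(r)}$ with some edge of $H$. $H_n^{(r)}(C)=\{e\in\binom{\Omega_n}{r}: e\cap[w_i,w_{i-1}]\neq\emptyset\ \forall i\}$. -}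

module Defs where

open import Data.Nat using (ℕ; zero; suc; _+_; _*_; _∸_; _≤_; _<_; _≤ᵇ_; _<ᵇ_)
open import Data.Nat.DivMod using (_mod_)
open import Data.Bool using (Bool; true; false; if_then_else_; _∧_)
open import Data.Fin using (Fin; toℕ)
open import Data.Fin.Subset using (Subset; _∈_; _⊆_; _∩_; ∣_∣; Nonempty; Empty)
open import Data.Vec using (tabulate)
open import Data.List using (List; []; _∷_; map; upTo; _++_)
open import Data.List.Relation.Unary.Linked using (Linked)
open import Data.Product using (Σ; ∃; _×_)
open import Data.Sum using (_⊎_)
open import Relation.Nullary using (¬_)

-- Ω_n = Fin n, with clockwise cyclic order 0 < 1 < ... < n-1 < 0.
-- dist a x = number of clockwise steps from a to x (in 0..n-1).
dist : {n : ℕ} → Fin n → Fin n → ℕ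
dist {n} a x = if toℕ a ≤ᵇ toℕ x then toℕ x ∸ toℕ a else (n ∸ toℕ a) + toℕ x

openI : {n : ℕ} → Fin n → Fin n → Subset n
openI a b = tabulate (λ x → (0 <ᵇ dist a x) ∧ (dist a x <ᵇ dist a b))

closedI : {n : ℕ} → Fin n → Fin n → Subset n
closedI a b = tabulate (λ x → dist a x ≤ᵇ dist a b)

-- a list x₁,…,x_k of points is a chain x₁ < … < x_k < x₁ : the clockwise
-- distances from x₁ strictly increase (hence the points are distinct and
-- appear in this clockwise cyclic order)
CyclicChain : {n : ℕ} → List (Fin n) → Set
CyclicChain [] = Data.Unit.⊤ where import Data.Unit
CyclicChain (x ∷ xs) = Linked _<_ (map (dist x) (x ∷ xs))

Disjoint : {n : ℕ} → Subset n → Subset n → Set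
Disjoint h₁ h₂ = Empty (h₁ ∩ h₂)

-- h₁, h₂ form a copy of M₁^(r) (the r-uniformity is imposed where used)
CopyM1 : {n : ℕ} → Subset n → Subset n → Set
CopyM1 {n} h₁ h₂ = Disjoint h₁ h₂ × ∃ λ (a : Fin n) → ∃ λ (b : Fin n) →
  (h₁ ⊆ closedI a b) × (h₂ ⊆ openI b a)

M1Saturated : {n : ℕ} (r : ℕ) → (Subset n → Set) → Set
M1Saturated {n} r H =
  (∀ e → H e → ∣ e ∣ ≡ r) ×
  (∀ h₁ h₂ → H h₁ → H h₂ → ¬ CopyM1 h₁ h₂) ×
  (∀ (e : Subset n) → ∣ e ∣ ≡ r → ¬ H e →
     ∃ λ h → H h × (CopyM1 e h ⊎ CopyM1 h e))
  where open import Relation.Binary.PropositionalEquality using (_≡_)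

-- The cycle C = (w_1,…,w_{2ℓ+1}) is encoded 0-indexed: paper's w_i is w (i-1).
-- predecessor index i-1 modulo 2ℓ+1
prevIdx : (ℓ : ℕ) → Fin (suc (2 * ℓ)) → Fin (suc (2 * ℓ))
prevIdx ℓ i = (toℕ i + 2 * ℓ) mod suc (2 * ℓ)

HC : {n : ℕ} (r ℓ : ℕ) → (Fin (suc (2 * ℓ)) → Fin n) → Subset n → Set
HC r ℓ w e = (∣ e ∣ ≡ r) × (∀ i → Nonempty (e ∩ closedI (w i) (w (prevIdx ℓ i))))
  where open import Relation.Binary.PropositionalEquality using (_≡_)

-- the order w_1,w_3,…,w_{2ℓ+1},w_2,w_4,…,w_{2ℓ}, 0-indexed: 0,2,…,2ℓ,1,3,…,2ℓ-1
chainOrder : (ℓ : ℕ) → List ℕ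
chainOrder ℓ = map (λ j → 2 * j) (upTo (suc ℓ)) ++ map (λ j → suc (2 * j)) (upTo ℓ)

chainList : {n : ℕ} (ℓ : ℕ) → (Fin (suc (2 * ℓ)) → Fin n) → List (Fin n)
chainList ℓ w = map (λ j → w (j mod suc (2 * ℓ))) (chainOrder ℓ)

-- Measure positions clockwise from w₁ (index 0 below). The chain condition says that the vertices of
-- even index come first, Ev 0 = 0 < Ev 1 < … < Ev ℓ, followed by those of odd index,
-- Od 0 < … < Od (ℓ-1); the arcs [w_i, w_{i-1}] are then [Ev 0, Ev ℓ], [Ev (s+1), Od s] and the
-- arcs [Od s, Ev s] that wrap past w₁. Every arc contains an endpoint of every other arc, so any
-- r-set through both endpoints of an arc is an edge; an r-set missing some arc lies in the
-- complementary open arc and forms a copy of M₁ with such an edge. Conversely, a copy of M₁ puts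
-- one edge S inside an open interval (lo, hi) of positions and the other edge T outside it; then
-- S meeting [Od t, Ev t] and T meeting [Ev (t+1), Od t] force Ev t ≤ lo for all t, so S cannot
-- meet [Ev 0, Ev ℓ].
{-# OPTIONS --safe #-}
module Submission where

open import Level using (Level)
open import Function using (_∘_)
open import Function.Bundles using (Equivalence)
open import Function.Definitions using (Injective)
open import Relation.Nullary using (¬_; yes; no; contradiction)
open import Relation.Nullary.Reflects using (ofʸ; ofⁿ)
open import Relation.Binary.Core using (Rel)
open import Relation.Binary.PropositionalEquality
open import Data.Bool using (Bool; true; false; if_then_else_; T)
open import Data.Bool.Properties using (T-≡; T-∧)
open import Data.Product using (∃; ∃₂; _×_; _,_; proj₁; proj₂; uncurry)
import Data.Product as Product
open import Data.Sum using (_⊎_; inj₁; inj₂; [_,_]′)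
import Data.Sum as Sum
open import Data.Nat
open import Data.Nat.Properties
open import Data.Nat.DivMod
open import Data.Fin using (Fin; toℕ; fromℕ<)
import Data.Fin as Fin
open import Data.Fin.Properties using (toℕ<n; toℕ-injective; toℕ-fromℕ<; ¬∀⟶∃¬)
open import Data.Fin.Subset using (Subset; _∈_; _∉_; _⊆_; _∪_; _∩_; ⁅_⁆; ∣_∣; Nonempty; Empty)
open import Data.Fin.Subset.Properties
  using (drop-∷-⊆; out⊆; in⊆in; ⊆-refl; x∈⁅x⁆; x∈⁅y⁆⇒x≡y; ∣⁅x⁆∣≡1; x∈p∪q⁺; x∈p∪q⁻; x∈p∩q⁺; x∈p∩q⁻; nonempty?)
open import Data.Vec using ([]; _∷_; here; tabulate)
open import Data.Vec.Properties using ([]=⇒lookup; lookup⇒[]=; lookup∘tabulate)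
open import Data.List using ([]; _∷_; _++_; map; upTo; applyUpTo)
open import Data.List.Properties using (map-∘; map-++; map-upTo)
open import Data.List.Relation.Unary.All using (All; []; _∷_)
open import Data.List.Relation.Unary.All.Properties using (applyUpTo⁻; ++⁻)
open import Data.List.Relation.Unary.AllPairs using (AllPairs; []; _∷_)
open import Data.List.Relation.Unary.Linked.Properties using (Linked⇒AllPairs)
open import Defs
open ≡-Reasoning

cwDist : ℕ → ℕ → ℕ → ℕ
cwDist N A X = if A ≤ᵇ X then X ∸ A else N ∸ A + X

m∸o≤n∸o⇒m≤n : ∀ {m n o} → o ≤ m → o ≤ n → m ∸ o ≤ n ∸ o → m ≤ n
m∸o≤n∸o⇒m≤n {o = o} o≤m o≤n le = subst₂ _≤_ (m+[n∸m]≡n o≤m) (m+[n∸m]≡n o≤n) (+-monoʳ-≤ o le)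

m∸o<n∸o⇒m<n : ∀ {m n o} → o ≤ m → o ≤ n → m ∸ o < n ∸ o → m < n
m∸o<n∸o⇒m<n {o = o} o≤m o≤n lt = subst₂ _<_ (m+[n∸m]≡n o≤m) (m+[n∸m]≡n o≤n) (+-monoʳ-< o lt)

[m%n+o]%n≡[m+o]%n : ∀ m o n .{{_ : NonZero n}} → (m % n + o) % n ≡ (m + o) % n
[m%n+o]%n≡[m+o]%n m o n = begin
  (m % n + o) % n           ≡⟨ %-distribˡ-+ (m % n) o n ⟩
  (m % n % n + o % n) % n   ≡⟨ cong (λ k → (k + o % n) % n) (m%n%n≡m%n m n) ⟩
  (m % n + o % n) % n       ≡⟨ %-distribˡ-+ m o n ⟨
  (m + o) % n               ∎

module _ {N : ℕ} .{{_ : NonZero N}} where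

  %-cancelˡ-+ : ∀ c {m n} → c ≤ N → (c + m) % N ≡ (c + n) % N → m % N ≡ n % N
  %-cancelˡ-+ c {m} {n} c≤N eq =
    trans (sym (undo m)) (trans (cong (λ j → (j + (N ∸ c)) % N) eq) (undo n))
    where
    undo : ∀ k → ((c + k) % N + (N ∸ c)) % N ≡ k % N
    undo k = begin
      ((c + k) % N + (N ∸ c)) % N   ≡⟨ [m%n+o]%n≡[m+o]%n (c + k) (N ∸ c) N ⟩
      (c + k + (N ∸ c)) % N         ≡⟨ cong (λ j → (j + (N ∸ c)) % N) (+-comm c k) ⟩
      (k + c + (N ∸ c)) % N         ≡⟨ cong (_% N) (+-assoc k c (N ∸ c)) ⟩
      (k + (c + (N ∸ c))) % N       ≡⟨ cong (λ j → (k + j) % N) (m+[n∸m]≡n c≤N) ⟩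
      (k + N) % N                   ≡⟨ [m+n]%n≡m%n k N ⟩
      k % N                         ∎

  cwDist-≤ : ∀ {A X} → A ≤ X → cwDist N A X ≡ X ∸ A
  cwDist-≤ {A} {X} A≤X with A ≤ᵇ X | ≤ᵇ-reflects-≤ A X
  ... | true  | _        = refl
  ... | false | ofⁿ A≰X = contradiction A≤X A≰X

  cwDist-> : ∀ {A X} → X < A → cwDist N A X ≡ N ∸ A + X
  cwDist-> {A} {X} X<A with A ≤ᵇ X | ≤ᵇ-reflects-≤ A X
  ... | false | _        = refl
  ... | true  | ofʸ A≤X = contradiction A≤X (<⇒≱ X<A)

  cwDist-self : ∀ A → cwDist N A A ≡ 0
  cwDist-self A = trans (cwDist-≤ (≤-refl {A})) (n∸n≡0 A)

  cwDist<N : ∀ {A X} → A < N → X < N → cwDist N A X < N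
  cwDist<N {A} {X} A<N X<N with A ≤? X
  ... | yes A≤X rewrite cwDist-≤ A≤X = ≤-<-trans (m∸n≤m X A) X<N
  ... | no  A≰X rewrite cwDist-> (≰⇒> A≰X) =
    subst (N ∸ A + X <_) (m∸n+n≡m (<⇒≤ A<N)) (+-monoʳ-< (N ∸ A) (≰⇒> A≰X))

  +-cwDist : ∀ {A X} → A < N → X < N → (A + cwDist N A X) % N ≡ X
  +-cwDist {A} {X} A<N X<N with A ≤? X
  ... | yes A≤X rewrite cwDist-≤ A≤X | m+[n∸m]≡n A≤X = m<n⇒m%n≡m X<N
  ... | no  A≰X rewrite cwDist-> (≰⇒> A≰X) = begin
    (A + (N ∸ A + X)) % N   ≡⟨ cong (_% N) (+-assoc A (N ∸ A) X) ⟨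
    (A + (N ∸ A) + X) % N   ≡⟨ cong (λ j → (j + X) % N) (m+[n∸m]≡n (<⇒≤ A<N)) ⟩
    (N + X) % N             ≡⟨ cong (_% N) (+-comm N X) ⟩
    (X + N) % N             ≡⟨ [m+n]%n≡m%n X N ⟩
    X % N                   ≡⟨ m<n⇒m%n≡m X<N ⟩
    X                       ∎

  cwDist-unique : ∀ {A X D} → A < N → X < N → D < N → (A + D) % N ≡ X → cwDist N A X ≡ D
  cwDist-unique {A} {X} {D} A<N X<N D<N eq = begin
    cwDist N A X       ≡⟨ m<n⇒m%n≡m (cwDist<N A<N X<N) ⟨
    cwDist N A X % N   ≡⟨ %-cancelˡ-+ A (<⇒≤ A<N) (trans (+-cwDist A<N X<N) (sym eq)) ⟩
    D % N              ≡⟨ m<n⇒m%n≡m D<N ⟩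
    D                  ∎

  cwDist-translate : ∀ {C A X} → C < N → A < N → X < N →
                     cwDist N (cwDist N C A) (cwDist N C X) ≡ cwDist N A X
  cwDist-translate {C} {A} {X} C<N A<N X<N =
    cwDist-unique CA<N CX<N (cwDist<N A<N X<N) CA+AX≡CX
    where
    CA<N = cwDist<N C<N A<N
    CX<N = cwDist<N C<N X<N
    CA+AX≡CX : (cwDist N C A + cwDist N A X) % N ≡ cwDist N C X
    CA+AX≡CX = trans (%-cancelˡ-+ C (<⇒≤ C<N) (begin
      (C + (cwDist N C A + cwDist N A X)) % N   ≡⟨ cong (_% N) (+-assoc C _ _) ⟨
      (C + cwDist N C A + cwDist N A X) % N     ≡⟨ [m%n+o]%n≡[m+o]%n (C + cwDist N C A) _ N ⟨
      ((C + cwDist N C A) % N + cwDist N A X) % N ≡⟨ cong (λ j → (j + cwDist N A X) % N) (+-cwDist C<N A<N) ⟩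
      (A + cwDist N A X) % N                    ≡⟨ +-cwDist A<N X<N ⟩
      X                                         ≡⟨ +-cwDist C<N X<N ⟨
      (C + cwDist N C X) % N                    ∎))
      (m<n⇒m%n≡m CX<N)

  closedArc-linear⁻ : ∀ {A B X} → B < N → A ≤ B →
                      cwDist N A X ≤ cwDist N A B → A ≤ X × X ≤ B
  closedArc-linear⁻ {A} {B} {X} B<N A≤B le with A ≤? X
  ... | yes A≤X rewrite cwDist-≤ A≤X | cwDist-≤ A≤B = A≤X , m∸o≤n∸o⇒m≤n A≤X A≤B le
  ... | no  A≰X rewrite cwDist-> (≰⇒> A≰X) | cwDist-≤ A≤B =
    contradiction (≤-trans (m≤m+n (N ∸ A) X) le) (<⇒≱ (∸-monoˡ-< B<N A≤B))

  closedArc-linear⁺ : ∀ {A B X} → A ≤ X → X ≤ B → cwDist N A X ≤ cwDist N A B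
  closedArc-linear⁺ {A} A≤X X≤B rewrite cwDist-≤ A≤X | cwDist-≤ (≤-trans A≤X X≤B) =
    ∸-monoˡ-≤ A X≤B

  closedArc-wrap⁻ : ∀ {A B X} → B < A → cwDist N A X ≤ cwDist N A B → A ≤ X ⊎ X ≤ B
  closedArc-wrap⁻ {A} {B} {X} B<A le with A ≤? X
  ... | yes A≤X = inj₁ A≤X
  ... | no  A≰X rewrite cwDist-> (≰⇒> A≰X) | cwDist-> B<A = inj₂ (+-cancelˡ-≤ (N ∸ A) X B le)

  closedArc-wrap⁺ : ∀ {A B X} → X < N → B < A → A ≤ X ⊎ X ≤ B → cwDist N A X ≤ cwDist N A B
  closedArc-wrap⁺ {A} {B} {X} X<N B<A (inj₁ A≤X) rewrite cwDist-≤ A≤X | cwDist-> B<A =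
    ≤-trans (∸-monoˡ-≤ A (<⇒≤ X<N)) (m≤m+n (N ∸ A) B)
  closedArc-wrap⁺ {A} {B} {X} X<N B<A (inj₂ X≤B) rewrite cwDist-> (≤-<-trans X≤B B<A) | cwDist-> B<A =
    +-monoʳ-≤ (N ∸ A) X≤B

  openArc-linear⁻ : ∀ {A B X} → B < N → A < B →
                    0 < cwDist N A X → cwDist N A X < cwDist N A B → A < X × X < B
  openArc-linear⁻ {A} {B} {X} B<N A<B pos lt with A ≤? X
  ... | yes A≤X rewrite cwDist-≤ A≤X | cwDist-≤ (<⇒≤ A<B) =
    m∸n≢0⇒n<m (>⇒≢ pos) , m∸o<n∸o⇒m<n A≤X (<⇒≤ A<B) lt
  ... | no  A≰X rewrite cwDist-> (≰⇒> A≰X) | cwDist-≤ (<⇒≤ A<B) =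
    contradiction lt (≤⇒≯ (≤-trans (∸-monoˡ-≤ A (<⇒≤ B<N)) (m≤m+n (N ∸ A) X)))

  openArc-wrap⁻ : ∀ {A B X} → B ≤ A →
                  0 < cwDist N A X → cwDist N A X < cwDist N A B → A < X ⊎ X < B
  openArc-wrap⁻ {A} {B} {X} B≤A pos lt with A ≤? X
  ... | yes A≤X rewrite cwDist-≤ A≤X = inj₁ (m∸n≢0⇒n<m (>⇒≢ pos))
  ... | no  A≰X rewrite cwDist-> (≰⇒> A≰X) with A ≤? B
  ...   | yes A≤B rewrite cwDist-≤ A≤B | m≤n⇒m∸n≡0 B≤A = contradiction lt (≤⇒≯ z≤n)
  ...   | no  A≰B rewrite cwDist-> (≰⇒> A≰B) = inj₂ (+-cancelˡ-< (N ∸ A) X B lt)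

  openArc-to-0⁺ : ∀ {B X} → 0 < B → B < X → X < N →
                  0 < cwDist N B X × cwDist N B X < cwDist N B 0
  openArc-to-0⁺ {B} {X} 0<B B<X X<N
    rewrite cwDist-≤ (<⇒≤ B<X) | cwDist-> 0<B | +-identityʳ (N ∸ B) =
    m<n⇒0<n∸m B<X , ∸-monoˡ-< X<N (<⇒≤ B<X)

∈-tabulate⁻ : ∀ {n} {f : Fin n → Bool} {x} → x ∈ tabulate f → T (f x)
∈-tabulate⁻ {f = f} {x} x∈ =
  Equivalence.from T-≡ (trans (sym (lookup∘tabulate f x)) ([]=⇒lookup x∈))

∈-tabulate⁺ : ∀ {n} {f : Fin n → Bool} {x} → T (f x) → x ∈ tabulate f
∈-tabulate⁺ {f = f} {x} t =
  lookup⇒[]= x (tabulate f) (trans (lookup∘tabulate f x) (Equivalence.to T-≡ t))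

module _ {N : ℕ} .{{_ : NonZero N}} where

  ∈closedI⁻ : ∀ (a b : Fin N) {x} → x ∈ closedI a b → dist a x ≤ dist a b
  ∈closedI⁻ a b {x} x∈ = ≤ᵇ⇒≤ (dist a x) (dist a b) (∈-tabulate⁻ x∈)

  ∈closedI⁺ : ∀ (a b : Fin N) {x} → dist a x ≤ dist a b → x ∈ closedI a b
  ∈closedI⁺ a b le = ∈-tabulate⁺ (≤⇒≤ᵇ le)

  ∈openI⁻ : ∀ (a b : Fin N) {x} → x ∈ openI a b → 0 < dist a x × dist a x < dist a b
  ∈openI⁻ a b {x} x∈ with Equivalence.to T-∧ (∈-tabulate⁻ x∈)
  ... | t₁ , t₂ = <ᵇ⇒< 0 (dist a x) t₁ , <ᵇ⇒< (dist a x) (dist a b) t₂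

  ∈openI⁺ : ∀ (a b : Fin N) {x} → 0 < dist a x → dist a x < dist a b → x ∈ openI a b
  ∈openI⁺ a b 0<ax ax<ab = ∈-tabulate⁺ (Equivalence.from T-∧ (<⇒<ᵇ 0<ax , <⇒<ᵇ ax<ab))

  dist<N : (a x : Fin N) → dist a x < N
  dist<N a x = cwDist<N (toℕ<n a) (toℕ<n x)

  dist-self : (a : Fin N) → dist a a ≡ 0
  dist-self a = cwDist-self (toℕ a)

  dist-translate : (c a x : Fin N) → cwDist N (dist c a) (dist c x) ≡ dist a x
  dist-translate c a x = cwDist-translate (toℕ<n c) (toℕ<n a) (toℕ<n x)

  start∈closedI : (a b : Fin N) → a ∈ closedI a b
  start∈closedI a b = ∈closedI⁺ a b (subst (_≤ dist a b) (sym (dist-self a)) z≤n)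

  end∈closedI : (a b : Fin N) → b ∈ closedI a b
  end∈closedI a b = ∈closedI⁺ a b ≤-refl

  dist≡0⇒≡ : ∀ {a b : Fin N} → dist a b ≡ 0 → a ≡ b
  dist≡0⇒≡ {a} {b} eq = toℕ-injective (begin
    toℕ a                  ≡⟨ m<n⇒m%n≡m (toℕ<n a) ⟨
    toℕ a % N              ≡⟨ cong (_% N) (+-identityʳ (toℕ a)) ⟨
    (toℕ a + 0) % N        ≡⟨ cong (λ d → (toℕ a + d) % N) eq ⟨
    (toℕ a + dist a b) % N ≡⟨ +-cwDist (toℕ<n a) (toℕ<n b) ⟩
    toℕ b                  ∎)

  ∉closedI⇒∈openI : ∀ {a b x : Fin N} → a ≢ b → x ∉ closedI a b → x ∈ openI b a
  ∉closedI⇒∈openI {a} {b} {x} a≢b x∉ with openArc-to-0⁺ 0<ab ab<ax (dist<N a x)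
    where
    0<ab : 0 < dist a b
    0<ab = n≢0⇒n>0 (λ ab≡0 → a≢b (dist≡0⇒≡ ab≡0))
    ab<ax : dist a b < dist a x
    ab<ax = ≰⇒> (λ ax≤ab → x∉ (∈closedI⁺ a b ax≤ab))
  ... | 0<bx , bx<ba = ∈openI⁺ b a (subst (0 <_) bx≡ 0<bx) (subst₂ _<_ bx≡ ba≡ bx<ba)
    where
    bx≡ = dist-translate a b x
    ba≡ = trans (cong (cwDist N (dist a b)) (sym (dist-self a))) (dist-translate a b a)

∣p∪q∣≤∣p∣+∣q∣ : ∀ {n} (p q : Subset n) → ∣ p ∪ q ∣ ≤ ∣ p ∣ + ∣ q ∣
∣p∪q∣≤∣p∣+∣q∣ []          []          = z≤n
∣p∪q∣≤∣p∣+∣q∣ (true ∷ p)  (true ∷ q)  = s≤s (≤-trans (∣p∪q∣≤∣p∣+∣q∣ p q) (+-monoʳ-≤ ∣ p ∣ (n≤1+n ∣ q ∣)))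
∣p∪q∣≤∣p∣+∣q∣ (true ∷ p)  (false ∷ q) = s≤s (∣p∪q∣≤∣p∣+∣q∣ p q)
∣p∪q∣≤∣p∣+∣q∣ (false ∷ p) (true ∷ q)  = subst (suc ∣ p ∪ q ∣ ≤_) (sym (+-suc ∣ p ∣ ∣ q ∣)) (s≤s (∣p∪q∣≤∣p∣+∣q∣ p q))
∣p∪q∣≤∣p∣+∣q∣ (false ∷ p) (false ∷ q) = ∣p∪q∣≤∣p∣+∣q∣ p q

⊆-interpolate : ∀ {n} r (K T : Subset n) → K ⊆ T → ∣ K ∣ ≤ r → r ≤ ∣ T ∣ →
                ∃ λ h → K ⊆ h × h ⊆ T × ∣ h ∣ ≡ r
⊆-interpolate r [] [] _ _ r≤0 = [] , ⊆-refl , ⊆-refl , sym (n≤0⇒n≡0 r≤0)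
⊆-interpolate r (true ∷ K) (false ∷ T) K⊆T _ _ with K⊆T here
... | ()
⊆-interpolate zero (true ∷ K) (true ∷ T) _ () _
⊆-interpolate (suc r) (true ∷ K) (true ∷ T) K⊆T (s≤s K≤r) (s≤s r≤T)
  with ⊆-interpolate r K T (drop-∷-⊆ K⊆T) K≤r r≤T
... | h , K⊆h , h⊆T , ∣h∣≡r = true ∷ h , in⊆in K⊆h , in⊆in h⊆T , cong suc ∣h∣≡r
⊆-interpolate r (false ∷ K) (false ∷ T) K⊆T K≤r r≤T
  with ⊆-interpolate r K T (drop-∷-⊆ K⊆T) K≤r r≤T
... | h , K⊆h , h⊆T , ∣h∣≡r = false ∷ h , out⊆ K⊆h , out⊆ h⊆T , ∣h∣≡r
⊆-interpolate r (false ∷ K) (true ∷ T) K⊆T K≤r r≤1+T with r ≤? ∣ T ∣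
... | no r≰T = true ∷ T , K⊆T , ⊆-refl , ≤-antisym (≰⇒> r≰T) r≤1+T
... | yes r≤T with ⊆-interpolate r K T (drop-∷-⊆ K⊆T) K≤r r≤T
...   | h , K⊆h , h⊆T , ∣h∣≡r = false ∷ h , out⊆ K⊆h , out⊆ h⊆T , ∣h∣≡r

pair-extends-to-size : ∀ {n} r {T : Subset n} {a b} → 2 ≤ r → r ≤ ∣ T ∣ → a ∈ T → b ∈ T →
                       ∃ λ h → a ∈ h × b ∈ h × h ⊆ T × ∣ h ∣ ≡ r
pair-extends-to-size r {T} {a} {b} 2≤r r≤T a∈T b∈T
  with ⊆-interpolate r (⁅ a ⁆ ∪ ⁅ b ⁆) T ab⊆T ∣ab∣≤r r≤T
  where
  ab⊆T : ⁅ a ⁆ ∪ ⁅ b ⁆ ⊆ T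
  ab⊆T x∈ with x∈p∪q⁻ ⁅ a ⁆ ⁅ b ⁆ x∈
  ... | inj₁ x∈a rewrite x∈⁅y⁆⇒x≡y a x∈a = a∈T
  ... | inj₂ x∈b rewrite x∈⁅y⁆⇒x≡y b x∈b = b∈T
  ∣ab∣≤r : ∣ ⁅ a ⁆ ∪ ⁅ b ⁆ ∣ ≤ r
  ∣ab∣≤r = ≤-trans (∣p∪q∣≤∣p∣+∣q∣ ⁅ a ⁆ ⁅ b ⁆)
             (subst₂ (λ i j → i + j ≤ r) (sym (∣⁅x⁆∣≡1 a)) (sym (∣⁅x⁆∣≡1 b)) 2≤r)
... | h , ab⊆h , h⊆T , ∣h∣≡r =
  h , ab⊆h (x∈p∪q⁺ (inj₁ (x∈⁅x⁆ a))) , ab⊆h (x∈p∪q⁺ (inj₂ (x∈⁅x⁆ b))) , h⊆T , ∣h∣≡r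

Inside : ℕ → ℕ → ℕ → Set
Inside lo hi p = lo < p × p < hi

module Positions {N : ℕ} .{{_ : NonZero N}} (c : Fin N) where

  pos : Fin N → ℕ
  pos = dist c

  pos<N : ∀ x → pos x < N
  pos<N = dist<N c

  ∈closedI⇒cwDist : ∀ {a b x} → x ∈ closedI a b → cwDist N (pos a) (pos x) ≤ cwDist N (pos a) (pos b)
  ∈closedI⇒cwDist {a} {b} {x} x∈ =
    subst₂ _≤_ (sym (dist-translate c a x)) (sym (dist-translate c a b)) (∈closedI⁻ a b x∈)

  cwDist⇒∈closedI : ∀ {a b x} → cwDist N (pos a) (pos x) ≤ cwDist N (pos a) (pos b) → x ∈ closedI a b
  cwDist⇒∈closedI {a} {b} {x} le =
    ∈closedI⁺ a b (subst₂ _≤_ (dist-translate c a x) (dist-translate c a b) le)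

  closedI-linear⁻ : ∀ {a b x A B} → pos a ≡ A → pos b ≡ B → A ≤ B →
                    x ∈ closedI a b → A ≤ pos x × pos x ≤ B
  closedI-linear⁻ {b = b} refl refl A≤B x∈ = closedArc-linear⁻ (pos<N b) A≤B (∈closedI⇒cwDist x∈)

  closedI-linear⁺ : ∀ a b {x A B} → pos a ≡ A → pos b ≡ B →
                    A ≤ pos x → pos x ≤ B → x ∈ closedI a b
  closedI-linear⁺ a b refl refl A≤x x≤B = cwDist⇒∈closedI (closedArc-linear⁺ A≤x x≤B)

  closedI-wrap⁻ : ∀ {a b x A B} → pos a ≡ A → pos b ≡ B → B < A →
                  x ∈ closedI a b → A ≤ pos x ⊎ pos x ≤ B
  closedI-wrap⁻ refl refl B<A x∈ = closedArc-wrap⁻ B<A (∈closedI⇒cwDist x∈)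

  closedI-wrap⁺ : ∀ a b {x A B} → pos a ≡ A → pos b ≡ B → B < A →
                  A ≤ pos x ⊎ pos x ≤ B → x ∈ closedI a b
  closedI-wrap⁺ a b {x} refl refl B<A x∈arc = cwDist⇒∈closedI (closedArc-wrap⁺ (pos<N x) B<A x∈arc)

  ∈openI⇒cwDist : ∀ {a b x} → x ∈ openI a b →
                  0 < cwDist N (pos a) (pos x) × cwDist N (pos a) (pos x) < cwDist N (pos a) (pos b)
  ∈openI⇒cwDist {a} {b} {x} x∈ with ∈openI⁻ a b x∈
  ... | 0<ax , ax<ab = subst (0 <_) (sym (dist-translate c a x)) 0<ax
                     , subst₂ _<_ (sym (dist-translate c a x)) (sym (dist-translate c a b)) ax<ab

  openI-linear⁻ : ∀ {a b x} → pos a < pos b → x ∈ openI a b → Inside (pos a) (pos b) (pos x)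
  openI-linear⁻ {b = b} a<b x∈ = uncurry (openArc-linear⁻ (pos<N b) a<b) (∈openI⇒cwDist x∈)

  openI-wrap⁻ : ∀ {a b x} → pos b ≤ pos a → x ∈ openI a b → pos a < pos x ⊎ pos x < pos b
  openI-wrap⁻ b≤a x∈ = uncurry (openArc-wrap⁻ b≤a) (∈openI⇒cwDist x∈)

  Separated : Subset N → Subset N → Set
  Separated S T = ∃₂ λ lo hi → (∀ {x} → x ∈ S → Inside lo hi (pos x))
                              × (∀ {x} → x ∈ T → ¬ Inside lo hi (pos x))

  copy⇒separated : ∀ {h₁ h₂} → CopyM1 h₁ h₂ → Separated h₁ h₂ ⊎ Separated h₂ h₁
  copy⇒separated {h₁} {h₂} (_ , a , b , h₁⊆ , h₂⊆) with pos b <? pos a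
  ... | yes b<a = inj₂ (pos b , pos a , openI-linear⁻ b<a ∘ h₂⊆ , h₁-outside)
    where
    h₁-outside : ∀ {x} → x ∈ h₁ → ¬ Inside (pos b) (pos a) (pos x)
    h₁-outside x∈ (b<x , x<a) with closedI-wrap⁻ refl refl b<a (h₁⊆ x∈)
    ... | inj₁ a≤x = <⇒≱ x<a a≤x
    ... | inj₂ x≤b = <⇒≱ b<x x≤b
  ... | no b≮a = separate-linear (≮⇒≥ b≮a) (pos a) refl
    where
    -- The interval (lo, hi) is open, so it can hold h₁ ⊆ [pos a, pos b] only when pos a > 0;
    -- when pos a = 0 it holds h₂ ⊆ (pos b, N) instead.
    separate-linear : pos a ≤ pos b → ∀ A → pos a ≡ A → Separated h₁ h₂ ⊎ Separated h₂ h₁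
    separate-linear a≤b zero pa≡0 = inj₂ (pos b , N , h₂-inside , h₁-outside)
      where
      h₂-inside : ∀ {x} → x ∈ h₂ → Inside (pos b) N (pos x)
      h₂-inside {x} x∈ with openI-wrap⁻ a≤b (h₂⊆ x∈)
      ... | inj₁ b<x = b<x , pos<N x
      ... | inj₂ x<a = contradiction (subst (pos x <_) pa≡0 x<a) n≮0
      h₁-outside : ∀ {x} → x ∈ h₁ → ¬ Inside (pos b) N (pos x)
      h₁-outside x∈ (b<x , _) = <⇒≱ b<x (proj₂ (closedI-linear⁻ refl refl a≤b (h₁⊆ x∈)))
    separate-linear a≤b (suc A) pa≡ = inj₁ (A , suc (pos b) , h₁-inside , h₂-outside)
      where
      h₁-inside : ∀ {x} → x ∈ h₁ → Inside A (suc (pos b)) (pos x)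
      h₁-inside x∈ with closedI-linear⁻ refl refl a≤b (h₁⊆ x∈)
      ... | a≤x , x≤b = subst (_≤ _) pa≡ a≤x , s≤s x≤b
      h₂-outside : ∀ {x} → x ∈ h₂ → ¬ Inside A (suc (pos b)) (pos x)
      h₂-outside {x} x∈ (A<x , x<1+b) with openI-wrap⁻ a≤b (h₂⊆ x∈)
      ... | inj₁ b<x = <⇒≱ b<x (s≤s⁻¹ x<1+b)
      ... | inj₂ x<a = <⇒≱ A<x (s≤s⁻¹ (subst (pos x <_) pa≡ x<a))

module _ (e o : ℕ → ℕ) (ℓ lo hi : ℕ) where

  no-interval-separates :
    e 0 ≡ 0 →
    (∀ {t} → t < ℓ → ∃ λ x → Inside lo hi x × (o t ≤ x ⊎ x ≤ e t)) →
    (∀ {t} → t < ℓ → ∃ λ y → ¬ Inside lo hi y × (e (suc t) ≤ y × y ≤ o t)) →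
    ¬ (∃ λ x → Inside lo hi x × x ≤ e ℓ)
  no-interval-separates e0≡0 odd even (x , (lo<x , _) , x≤eℓ) =
    <⇒≱ lo<x (≤-trans x≤eℓ (below ℓ ≤-refl))
    where
    below : ∀ t → t ≤ ℓ → e t ≤ lo
    below zero    _   = subst (_≤ lo) (sym e0≡0) z≤n
    below (suc t) t<ℓ with odd t<ℓ | even t<ℓ
    ... | x , (lo<x , _) , inj₂ x≤et | _ =
      contradiction (≤-trans x≤et (below t (<⇒≤ t<ℓ))) (<⇒≱ lo<x)
    ... | x , (_ , x<hi) , inj₁ ot≤x | y , y-outside , e₁≤y , y≤ot with e (suc t) ≤? lo
    ...   | yes e₁≤lo = e₁≤lo
    ...   | no  e₁≰lo =
      contradiction (<-≤-trans (≰⇒> e₁≰lo) e₁≤y , ≤-<-trans (≤-trans y≤ot ot≤x) x<hi) y-outside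

module _ {a r : Level} {A : Set a} {R : Rel A r} where

  AllPairs-++⁻ : ∀ xs {ys} → AllPairs R (xs ++ ys) →
                 AllPairs R xs × AllPairs R ys × All (λ x → All (R x) ys) xs
  AllPairs-++⁻ []       ys↗ = [] , ys↗ , []
  AllPairs-++⁻ (x ∷ xs) (x<xs++ys ∷ xs++ys↗) with AllPairs-++⁻ xs xs++ys↗
  ... | xs↗ , ys↗ , xs<ys with ++⁻ xs x<xs++ys
  ...   | x<xs , x<ys = x<xs ∷ xs↗ , ys↗ , x<ys ∷ xs<ys

  AllPairs-applyUpTo⁻ : ∀ (f : ℕ → A) n {i j} → AllPairs R (applyUpTo f n) → i < j → j < n → R (f i) (f j)
  AllPairs-applyUpTo⁻ f (suc n) {zero}  {suc j} (f0<fs ∷ _) _ (s≤s j<n) = applyUpTo⁻ (f ∘ suc) n f0<fs j<n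
  AllPairs-applyUpTo⁻ f (suc n) {suc i} {suc j} (_ ∷ fs↗) (s≤s i<j) (s≤s j<n) =
    AllPairs-applyUpTo⁻ (f ∘ suc) n fs↗ i<j j<n

even⊎odd : ∀ k → ∃ λ q → k ≡ 2 * q ⊎ k ≡ suc (2 * q)
even⊎odd zero = 0 , inj₁ refl
even⊎odd (suc k) with even⊎odd k
... | q , inj₁ k≡2q   = q , inj₂ (cong suc k≡2q)
... | q , inj₂ k≡2q+1 = suc q , inj₁ (trans (cong suc k≡2q+1) (sym (*-suc 2 q)))

data IndexView (ℓ k : ℕ) : Set where
  first : k ≡ 0 → IndexView ℓ k
  even  : ∀ s → s < ℓ → k ≡ 2 * suc s → IndexView ℓ k
  odd   : ∀ s → s < ℓ → k ≡ suc (2 * s) → IndexView ℓ k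

indexView : ∀ {ℓ} k → k < suc (2 * ℓ) → IndexView ℓ k
indexView {ℓ} k k<L with even⊎odd k
... | zero  , inj₁ k≡0      = first k≡0
... | suc s , inj₁ k≡2[s+1] = even s (*-cancelˡ-≤ 2 (s≤s⁻¹ (subst (_< suc (2 * ℓ)) k≡2[s+1] k<L))) k≡2[s+1]
... | s     , inj₂ k≡2s+1   = odd s (*-cancelˡ-< 2 s ℓ (s≤s⁻¹ (subst (_< suc (2 * ℓ)) k≡2s+1 k<L))) k≡2s+1

module Cycle {N : ℕ} .{{_ : NonZero N}} (ℓ : ℕ) (w : Fin (suc (2 * ℓ)) → Fin N) where

  private
    L = suc (2 * ℓ)

  -- w (prevIdx ℓ i) is W (toℕ i + 2 * ℓ) by definition.
  W : ℕ → Fin N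
  W k = w (k mod L)

  open Positions (W 0) public

  Ev Od : ℕ → ℕ
  Ev s = pos (W (2 * s))
  Od s = pos (W (suc (2 * s)))

  Ev0≡0 : Ev 0 ≡ 0
  Ev0≡0 = dist-self (W 0)

  I : Fin L → Subset N
  I i = closedI (w i) (w (prevIdx ℓ i))

  w≡W : ∀ i → w i ≡ W (toℕ i)
  w≡W i = cong w (toℕ-injective (sym (trans (toℕ-fromℕ< _) (m<n⇒m%n≡m (toℕ<n i)))))

  W-pred : ∀ k → W (suc k + 2 * ℓ) ≡ W k
  W-pred k = cong w (toℕ-injective (begin
    toℕ ((suc k + 2 * ℓ) mod L)   ≡⟨ toℕ-fromℕ< _ ⟩
    (suc k + 2 * ℓ) % L           ≡⟨ cong (_% L) (+-suc k (2 * ℓ)) ⟨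
    (k + L) % L                   ≡⟨ [m+n]%n≡m%n k L ⟩
    k % L                         ≡⟨ toℕ-fromℕ< _ ⟨
    toℕ (k mod L)                 ∎))

  start end : ∀ {k} → IndexView ℓ k → ℕ
  start (first _)    = Ev 0
  start (even s _ _) = Ev (suc s)
  start (odd s _ _)  = Od s
  end (first _)      = Ev ℓ
  end (even s _ _)   = Od s
  end (odd s _ _)    = Ev s

  Arc : ∀ {k} → IndexView ℓ k → ℕ → Set
  Arc (first _)    p = p ≤ Ev ℓ
  Arc (even s _ _) p = Ev (suc s) ≤ p × p ≤ Od s
  Arc (odd s _ _)  p = Od s ≤ p ⊎ p ≤ Ev s

  pos-start : ∀ i (v : IndexView ℓ (toℕ i)) → pos (w i) ≡ start v
  pos-start i (first i≡0)       = cong pos (trans (w≡W i) (cong W i≡0))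
  pos-start i (even _ _ i≡2s+2) = cong pos (trans (w≡W i) (cong W i≡2s+2))
  pos-start i (odd _ _ i≡2s+1)  = cong pos (trans (w≡W i) (cong W i≡2s+1))

  pos-end : ∀ i (v : IndexView ℓ (toℕ i)) → pos (w (prevIdx ℓ i)) ≡ end v
  pos-end i (first i≡0)       = cong (λ k → pos (W (k + 2 * ℓ))) i≡0
  pos-end i (even s _ i≡2s+2) =
    cong pos (trans (cong (λ k → W (k + 2 * ℓ)) (trans i≡2s+2 (*-suc 2 s))) (W-pred (suc (2 * s))))
  pos-end i (odd s _ i≡2s+1)  = cong pos (trans (cong (λ k → W (k + 2 * ℓ)) i≡2s+1) (W-pred (2 * s)))

  view : (i : Fin L) → IndexView ℓ (toℕ i)
  view i = indexView (toℕ i) (toℕ<n i)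

  module Ordered (chain : CyclicChain (chainList ℓ w)) where

    chain-positions : map pos (chainList ℓ w) ≡ applyUpTo Ev (suc ℓ) ++ applyUpTo Od ℓ
    chain-positions = begin
      map pos (map W (evens ++ odds))             ≡⟨ map-∘ (evens ++ odds) ⟨
      map (pos ∘ W) (evens ++ odds)               ≡⟨ map-++ (pos ∘ W) evens odds ⟩
      map (pos ∘ W) evens ++ map (pos ∘ W) odds   ≡⟨ cong₂ _++_
                                                       (trans (sym (map-∘ (upTo (suc ℓ)))) (map-upTo Ev (suc ℓ)))
                                                       (trans (sym (map-∘ (upTo ℓ))) (map-upTo Od ℓ)) ⟩
      applyUpTo Ev (suc ℓ) ++ applyUpTo Od ℓ      ∎
      where
      evens = map (λ j → 2 * j) (upTo (suc ℓ))
      odds  = map (λ j → suc (2 * j)) (upTo ℓ)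

    sorted : AllPairs _<_ (applyUpTo Ev (suc ℓ) ++ applyUpTo Od ℓ)
    sorted = subst (AllPairs _<_) chain-positions (Linked⇒AllPairs <-trans chain)

    Ev-< : ∀ {i j} → i < j → j ≤ ℓ → Ev i < Ev j
    Ev-< i<j j≤ℓ = AllPairs-applyUpTo⁻ Ev (suc ℓ) (proj₁ (AllPairs-++⁻ _ sorted)) i<j (s≤s j≤ℓ)

    Od-< : ∀ {i j} → i < j → j < ℓ → Od i < Od j
    Od-< = AllPairs-applyUpTo⁻ Od ℓ (proj₁ (proj₂ (AllPairs-++⁻ _ sorted)))

    Ev<Od : ∀ {i j} → i ≤ ℓ → j < ℓ → Ev i < Od j
    Ev<Od i≤ℓ = applyUpTo⁻ Od ℓ (applyUpTo⁻ Ev (suc ℓ) (proj₂ (proj₂ (AllPairs-++⁻ _ sorted))) (s≤s i≤ℓ))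

    Ev-≤ : ∀ {i j} → i ≤ j → j ≤ ℓ → Ev i ≤ Ev j
    Ev-≤ i≤j j≤ℓ with m≤n⇒m<n∨m≡n i≤j
    ... | inj₁ i<j  = <⇒≤ (Ev-< i<j j≤ℓ)
    ... | inj₂ refl = ≤-refl

    Od-≤ : ∀ {i j} → i ≤ j → j < ℓ → Od i ≤ Od j
    Od-≤ i≤j j<ℓ with m≤n⇒m<n∨m≡n i≤j
    ... | inj₁ i<j  = <⇒≤ (Od-< i<j j<ℓ)
    ... | inj₂ refl = ≤-refl

    ∈I⁻ : ∀ {i x} (v : IndexView ℓ (toℕ i)) → x ∈ I i → Arc v (pos x)
    ∈I⁻ {i} v@(first _) x∈ =
      proj₂ (closedI-linear⁻ (pos-start i v) (pos-end i v) (Ev-≤ z≤n ≤-refl) x∈)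
    ∈I⁻ {i} v@(even _ s<ℓ _) x∈ =
      closedI-linear⁻ (pos-start i v) (pos-end i v) (<⇒≤ (Ev<Od s<ℓ s<ℓ)) x∈
    ∈I⁻ {i} v@(odd _ s<ℓ _) x∈ =
      closedI-wrap⁻ (pos-start i v) (pos-end i v) (Ev<Od (<⇒≤ s<ℓ) s<ℓ) x∈

    ∈I⁺ : ∀ {i x} (v : IndexView ℓ (toℕ i)) → Arc v (pos x) → x ∈ I i
    ∈I⁺ {i} {x} v@(first _) x≤Evℓ =
      closedI-linear⁺ _ _ (pos-start i v) (pos-end i v) (subst (_≤ pos x) (sym Ev0≡0) z≤n) x≤Evℓ
    ∈I⁺ {i} v@(even _ _ _) (Ev≤x , x≤Od) =
      closedI-linear⁺ _ _ (pos-start i v) (pos-end i v) Ev≤x x≤Od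
    ∈I⁺ {i} v@(odd _ s<ℓ _) x∈arc =
      closedI-wrap⁺ _ _ (pos-start i v) (pos-end i v) (Ev<Od (<⇒≤ s<ℓ) s<ℓ) x∈arc

    arcs-meet-endpoints : ∀ {k k′} (v : IndexView ℓ k) (u : IndexView ℓ k′) →
                          Arc u (start v) ⊎ Arc u (end v)
    arcs-meet-endpoints (first _) (first _) = inj₁ (Ev-≤ z≤n ≤-refl)
    arcs-meet-endpoints (first _) (even t t<ℓ _) = inj₂ (Ev-≤ t<ℓ ≤-refl , <⇒≤ (Ev<Od ≤-refl t<ℓ))
    arcs-meet-endpoints (first _) (odd t t<ℓ _) = inj₁ (inj₂ (Ev-≤ z≤n (<⇒≤ t<ℓ)))
    arcs-meet-endpoints (even s s<ℓ _) (first _) = inj₁ (Ev-≤ s<ℓ ≤-refl)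
    arcs-meet-endpoints (even s s<ℓ _) (even t t<ℓ _) with t ≤? s
    ... | yes t≤s = inj₁ (Ev-≤ (s≤s t≤s) s<ℓ , <⇒≤ (Ev<Od s<ℓ t<ℓ))
    ... | no  t≰s = inj₂ (<⇒≤ (Ev<Od t<ℓ s<ℓ) , Od-≤ (<⇒≤ (≰⇒> t≰s)) t<ℓ)
    arcs-meet-endpoints (even s s<ℓ _) (odd t t<ℓ _) with suc s ≤? t
    ... | yes s<t = inj₁ (inj₂ (Ev-≤ s<t (<⇒≤ t<ℓ)))
    ... | no  s≮t = inj₂ (inj₁ (Od-≤ (s≤s⁻¹ (≰⇒> s≮t)) s<ℓ))
    arcs-meet-endpoints (odd s s<ℓ _) (first _) = inj₂ (Ev-≤ (<⇒≤ s<ℓ) ≤-refl)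
    arcs-meet-endpoints (odd s s<ℓ _) (even t t<ℓ _) with suc t ≤? s
    ... | yes t<s = inj₂ (Ev-≤ t<s (<⇒≤ s<ℓ) , <⇒≤ (Ev<Od (<⇒≤ s<ℓ) t<ℓ))
    ... | no  t≮s = inj₁ (<⇒≤ (Ev<Od t<ℓ s<ℓ) , Od-≤ (s≤s⁻¹ (≰⇒> t≮s)) t<ℓ)
    arcs-meet-endpoints (odd s s<ℓ _) (odd t t<ℓ _) with t ≤? s
    ... | yes t≤s = inj₁ (inj₁ (Od-≤ t≤s s<ℓ))
    ... | no  t≰s = inj₂ (inj₂ (Ev-≤ (<⇒≤ (≰⇒> t≰s)) (<⇒≤ t<ℓ)))

    start≢end : 0 < ℓ → ∀ {k} (v : IndexView ℓ k) → start v ≢ end v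
    start≢end 0<ℓ (first _)      = <⇒≢ (Ev-< 0<ℓ ≤-refl)
    start≢end _   (even s s<ℓ _) = <⇒≢ (Ev<Od s<ℓ s<ℓ)
    start≢end _   (odd s s<ℓ _)  = >⇒≢ (Ev<Od (<⇒≤ s<ℓ) s<ℓ)

    endpoints-hit : ∀ i j → w i ∈ I j ⊎ w (prevIdx ℓ i) ∈ I j
    endpoints-hit i j = Sum.map (∈I⁺ (view j) ∘ subst (Arc (view j)) (sym (pos-start i (view i))))
                                (∈I⁺ (view j) ∘ subst (Arc (view j)) (sym (pos-end i (view i))))
                                (arcs-meet-endpoints (view i) (view j))

    endpoints⇒HC : ∀ {r h} i → w i ∈ h → w (prevIdx ℓ i) ∈ h → ∣ h ∣ ≡ r → HC r ℓ w h
    endpoints⇒HC i a∈h b∈h ∣h∣≡r = ∣h∣≡r , λ j →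
      [ (λ a∈I → w i , x∈p∩q⁺ (a∈h , a∈I)) , (λ b∈I → w (prevIdx ℓ i) , x∈p∩q⁺ (b∈h , b∈I)) ]′
        (endpoints-hit i j)

    meets-arc : ∀ {S} i (v : IndexView ℓ (toℕ i)) → Nonempty (S ∩ I i) → ∃ λ x → x ∈ S × Arc v (pos x)
    meets-arc {S} i v (x , x∈S∩I) with x∈p∩q⁻ S (I i) x∈S∩I
    ... | x∈S , x∈I = x , x∈S , ∈I⁻ v x∈I

    HC-unseparated : ∀ {r S T} → HC r ℓ w S → HC r ℓ w T → ¬ Separated S T
    HC-unseparated (_ , S-meets) (_ , T-meets) (lo , hi , S-inside , T-outside) =
      no-interval-separates Ev Od ℓ lo hi Ev0≡0 odd-arc even-arc first-arc
      where
      odd-arc : ∀ {t} → t < ℓ → ∃ λ x → Inside lo hi x × (Od t ≤ x ⊎ x ≤ Ev t)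
      odd-arc {t} t<ℓ with meets-arc _ (odd t t<ℓ (toℕ-fromℕ< i<L)) (S-meets (fromℕ< i<L))
        where i<L = s≤s (*-monoʳ-< 2 t<ℓ)
      ... | x , x∈S , x∈arc = pos x , S-inside x∈S , x∈arc
      even-arc : ∀ {t} → t < ℓ → ∃ λ y → ¬ Inside lo hi y × (Ev (suc t) ≤ y × y ≤ Od t)
      even-arc {t} t<ℓ with meets-arc _ (even t t<ℓ (toℕ-fromℕ< i<L)) (T-meets (fromℕ< i<L))
        where i<L = s≤s (*-monoʳ-≤ 2 t<ℓ)
      ... | y , y∈T , y∈arc = pos y , T-outside y∈T , y∈arc
      first-arc : ∃ λ x → Inside lo hi x × x ≤ Ev ℓ
      first-arc with meets-arc Fin.zero (first refl) (S-meets Fin.zero)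
      ... | x , x∈S , x∈arc = pos x , S-inside x∈S , x∈arc

    saturating : ∀ {r e} → 0 < ℓ → 2 ≤ r → (∀ i → r ≤ ∣ I i ∣) → ∣ e ∣ ≡ r → ¬ HC r ℓ w e →
                 ∃ λ h → HC r ℓ w h × CopyM1 h e
    saturating {r} {e} 0<ℓ 2≤r r≤∣I∣ ∣e∣≡r e∉H
      with ¬∀⟶∃¬ L (λ i → Nonempty (e ∩ I i)) (λ i → nonempty? (e ∩ I i)) (λ meets → e∉H (∣e∣≡r , meets))
    ... | i , e∩Ii=∅ with pair-extends-to-size r 2≤r (r≤∣I∣ i)
                            (start∈closedI (w i) (w (prevIdx ℓ i))) (end∈closedI (w i) (w (prevIdx ℓ i)))
    ... | h , a∈h , b∈h , h⊆Ii , ∣h∣≡r =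
      h , endpoints⇒HC i a∈h b∈h ∣h∣≡r , (h∩e=∅ , w i , w (prevIdx ℓ i) , h⊆Ii , e⊆openI)
      where
      h∩e=∅ : Empty (h ∩ e)
      h∩e=∅ (x , x∈h∩e) with x∈p∩q⁻ h e x∈h∩e
      ... | x∈h , x∈e = e∩Ii=∅ (x , x∈p∩q⁺ (x∈e , h⊆Ii x∈h))
      a≢b : w i ≢ w (prevIdx ℓ i)
      a≢b a≡b = start≢end 0<ℓ (view i)
        (trans (sym (pos-start i (view i))) (trans (cong pos a≡b) (pos-end i (view i))))
      e⊆openI : e ⊆ openI (w (prevIdx ℓ i)) (w i)
      e⊆openI {x} x∈e = ∉closedI⇒∈openI a≢b (λ x∈Ii → e∩Ii=∅ (x , x∈p∩q⁺ (x∈e , x∈Ii)))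

lemma3p3 : (n r ℓ : ℕ) → 2 ≤ r → 1 ≤ ℓ →
    (w : Fin (suc (2 * ℓ)) → Fin n) →
    Injective _≡_ _≡_ w →
    CyclicChain (chainList ℓ w) →
    (∀ i → r ≤ ∣ closedI (w i) (w (prevIdx ℓ i)) ∣) →
    M1Saturated r (HC r ℓ w)
lemma3p3 zero _ _ _ _ w _ _ _ with w Fin.zero
... | ()
lemma3p3 (suc _) r ℓ 2≤r 0<ℓ w _ chain r≤∣I∣ =
  (λ _ → proj₁) ,
  (λ _ _ H₁ H₂ copy → [ HC-unseparated H₁ H₂ , HC-unseparated H₂ H₁ ]′ (copy⇒separated copy)) ,
  (λ _ ∣e∣≡r e∉H → Product.map₂ (Product.map₂ inj₂) (saturating 0<ℓ 2≤r r≤∣I∣ ∣e∣≡r e∉H))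
  where
  open Cycle ℓ w
  open Ordered chain
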